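{- Let $G$ be a graph without isolated vertices and let $(C,H,R)$ be a crown decomposition of $G$ with $R=\emptyset$. If $G$ is well covered, then $|C|=|H|$.
   Context: A graph is well covered if all its minimal vertex covers have the same size (equivalently, all maximal independent sets have the same size). A crown decomposition of a graph $G$ is a partition of $V(G)$ into three parts $C$, $H$, $R$ such that: $C$ is nonempty; $C$ is an independent set; there are no edges between $C$ and $R$; and the edges between $C$ and $H$ contain a matching of size $|H|$. -}

module Defs where

open import Level using (0ℓ)
open import Data.Nat using (ℕ)
open import Data.Fin using (Fin)
open import Data.Fin.Subset using (Subset; _∈_; _∉_; _⊂_; ∣_∣; ⊥)
open import Data.Product using (Σ; ∃; _×_)
open import Data.Sum using (_⊎_)
open import Relation.Nullary using (¬_)
open import Relation.Binary.PropositionalEquality using (_≡_)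

record Graph : Set₁ where
  field
    n     : ℕ
    Adj   : Fin n → Fin n → Set
    sym   : ∀ {u v} → Adj u v → Adj v u
    irrefl : ∀ {v} → ¬ Adj v v

module _ (G : Graph) where
  open Graph G

  Vertex : Set
  Vertex = Fin n

  NoIsolatedVertices : Set
  NoIsolatedVertices = ∀ (v : Vertex) → ∃ λ u → Adj v u

  IsVertexCover : Subset n → Set
  IsVertexCover S = ∀ u v → Adj u v → u ∈ S ⊎ v ∈ S

  IsMinimalVertexCover : Subset n → Set
  IsMinimalVertexCover S = IsVertexCover S × (∀ T → T ⊂ S → ¬ IsVertexCover T)

  WellCovered : Set
  WellCovered = ∀ S T → IsMinimalVertexCover S → IsMinimalVertexCover T → ∣ S ∣ ≡ ∣ T ∣

  IsIndependent : Subset n → Set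
  IsIndependent S = ∀ u v → u ∈ S → v ∈ S → ¬ Adj u v

  -- A matching of size |H| inside the edges between C and H, written out as
  -- an injective map assigning to each h ∈ H a neighbour f h ∈ C.
  HasSaturatingMatching : Subset n → Subset n → Set
  HasSaturatingMatching C H =
    Σ (Vertex → Vertex) λ f →
      (∀ h → h ∈ H → f h ∈ C × Adj h (f h)) ×
      (∀ h h′ → h ∈ H → h′ ∈ H → f h ≡ f h′ → h ≡ h′)

  IsPartition₃ : Subset n → Subset n → Subset n → Set
  IsPartition₃ C H R =
    (∀ v → v ∈ C ⊎ v ∈ H ⊎ v ∈ R) ×
    (∀ v → v ∈ C → v ∉ H) × (∀ v → v ∈ C → v ∉ R) × (∀ v → v ∈ H → v ∉ R)

  IsCrownDecomposition : Subset n → Subset n → Subset n → Set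
  IsCrownDecomposition C H R =
    IsPartition₃ C H R ×
    (∃ λ v → v ∈ C) ×
    IsIndependent C ×
    (∀ c r → c ∈ C → r ∈ R → ¬ Adj c r) ×
    HasSaturatingMatching C H

-- With R empty, H is a vertex cover, and it is minimal because every h ∈ H has
-- its partner f h ∈ C outside H; the matching also gives |H| ≤ |C|. If some c ∈ C
-- were unmatched, pick a neighbour v of c and a minimal vertex cover S avoiding v,
-- so c ∈ S. Sending h ∈ H to h when h ∈ S and to f h otherwise (f h ∈ S, since S
-- covers the edge h f h) embeds H into S - c, whence |H| < |S|, contradicting
-- well-coveredness. So the matching is onto C and |C| = |H|.
-- Adjacency is not assumed decidable, but finding a minimal vertex cover needs it;
-- as the conclusion is a decidable equation and adjacency on a finite vertex set is
-- ¬¬-decidable, we may assume it.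

module Submission where

open import Defs
open import Data.Fin.Subset using (Subset; ∣_∣; ⊥)
open import Relation.Binary.PropositionalEquality using (_≡_)

open import Data.Bool.Base using (true; false)
open import Data.Empty using (⊥-elim)
open import Data.Fin.Base using (Fin; zero; suc)
open import Data.Fin.Properties using (any?; all?) renaming (_≟_ to _≟ᶠ_)
open import Data.Fin.Subset using (_∈_; _∉_; _⊆_; _⊂_; _-_; ⊤; ⁅_⁆)
open import Data.Fin.Subset.Induction using (⊂-wellFounded)
open import Data.Fin.Subset.Properties
  using ( _∈?_; _⊂?_; anySubset?; nonempty?; Empty-unique; ∣⊥∣≡0; ∈⊤; ∉⊥
        ; p─⊥≡p; p─q⊆p; x∈p∧x≢y⇒x∈p-y; x∈p⇒p-x⊂p; x∈p⇒∣p-x∣<∣p∣)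
open import Data.Nat.Base as ℕ using (ℕ; _≤_; z≤n; s≤s)
open import Data.Nat.Properties using (_≟_; ≤-antisym; <-irrefl; module ≤-Reasoning)
open import Data.Product.Base using (∃; _×_; _,_; proj₁; proj₂)
open import Data.Sum.Base using (_⊎_; inj₁; inj₂; [_,_]′)
open import Data.Vec.Base using (_∷_; here; there)
open import Function.Base using (_∘_; id)
open import Induction.WellFounded using (Acc; acc)
open import Level using (0ℓ)
open import Relation.Binary.Definitions using (Decidable)
open import Relation.Binary.PropositionalEquality using (_≢_; module ≡-Reasoning; refl; sym; cong; subst)
open import Relation.Nullary using (¬_; Dec; yes; no)
open import Relation.Nullary.Decidable using (_×-dec_; _⊎-dec_; _→-dec_; ¬¬-excluded-middle; decidable-stable)
open import Relation.Nullary.Negation using (¬¬-map)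
open import Relation.Unary as U using (Pred)

private
  variable
    m n : ℕ
    p q : Subset n
    x y : Fin n

x∈p-y⇒x≢y : ∀ {p : Subset n} → x ∈ p - y → x ≢ y
x∈p-y⇒x≢y {y = zero}  {p = _ ∷ _} (there _) ()
x∈p-y⇒x≢y {y = suc y} {p = _ ∷ _} here      ()
x∈p-y⇒x≢y {y = suc y} {p = _ ∷ _} (there x∈p-y) refl = x∈p-y⇒x≢y x∈p-y refl

x∈p⇒∣p∣≡1+∣p-x∣ : x ∈ p → ∣ p ∣ ≡ ℕ.suc ∣ p - x ∣
x∈p⇒∣p∣≡1+∣p-x∣ {p = true ∷ p}  here = cong (ℕ.suc ∘ ∣_∣) (sym (p─⊥≡p p))
x∈p⇒∣p∣≡1+∣p-x∣ {p = true ∷ _}  (there x∈p) = cong ℕ.suc (x∈p⇒∣p∣≡1+∣p-x∣ x∈p)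
x∈p⇒∣p∣≡1+∣p-x∣ {p = false ∷ _} (there x∈p) = x∈p⇒∣p∣≡1+∣p-x∣ x∈p

infix 4 _↪_

-- The image may depend on the membership proof, so that a map defined only on the
-- elements of p, such as the inverse of a matching, qualifies.
record _↪_ (p : Subset m) (q : Subset n) : Set where
  field
    to           : x ∈ p → Fin n
    to-∈         : (x∈p : x ∈ p) → to x∈p ∈ q
    to-injective : (x∈p : x ∈ p) (y∈p : y ∈ p) → to x∈p ≡ to y∈p → x ≡ y

open _↪_

removeImage : (ι : p ↪ q) (x∈p : x ∈ p) → p - x ↪ q - to ι x∈p
removeImage {p = p} {x = x} ι x∈p = record
  { to           = to ι ∘ keep
  ; to-∈         = λ y∈p-x → x∈p∧x≢y⇒x∈p-y (to-∈ ι (keep y∈p-x))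
                               (x∈p-y⇒x≢y y∈p-x ∘ to-injective ι (keep y∈p-x) x∈p)
  ; to-injective = λ y∈p-x z∈p-x → to-injective ι (keep y∈p-x) (keep z∈p-x)
  }
  where
  keep : y ∈ p - x → y ∈ p
  keep = p─q⊆p p ⁅ x ⁆

p↪q⇒∣p∣≤∣q∣ : p ↪ q → ∣ p ∣ ≤ ∣ q ∣
p↪q⇒∣p∣≤∣q∣ = go (⊂-wellFounded _)
  where
  go : ∀ {m n} {p : Subset m} {q : Subset n} → Acc _⊂_ p → p ↪ q → ∣ p ∣ ≤ ∣ q ∣
  go {m} {p = p} {q} (acc rec) ι with nonempty? p
  ... | no p≡∅ rewrite Empty-unique p≡∅ | ∣⊥∣≡0 m = z≤n
  ... | yes (x , x∈p) = begin
    ∣ p ∣                   ≡⟨ x∈p⇒∣p∣≡1+∣p-x∣ x∈p ⟩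
    ℕ.suc ∣ p - x ∣         ≤⟨ s≤s (go (rec (x∈p⇒p-x⊂p x∈p)) (removeImage ι x∈p)) ⟩
    ℕ.suc ∣ q - to ι x∈p ∣  ≤⟨ x∈p⇒∣p-x∣<∣p∣ (to-∈ ι x∈p) ⟩
    ∣ q ∣                   ∎
    where open ≤-Reasoning

⊂-minimal : {P : Pred (Subset n) 0ℓ} → U.Decidable P → P p →
  ∃ λ q → q ⊆ p × P q × (∀ r → r ⊂ q → ¬ P r)
⊂-minimal {P = P} P? = go (⊂-wellFounded _)
  where
  go : Acc _⊂_ p → P p → ∃ λ q → q ⊆ p × P q × (∀ r → r ⊂ q → ¬ P r)
  go {p} (acc rec) Pp with anySubset? (λ r → r ⊂? p ×-dec P? r)
  ... | no  ∄r = p , id , Pp , λ r r⊂p Pr → ∄r (r , r⊂p , Pr)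
  ... | yes (r , r⊂p , Pr) =
    let q , q⊆r , Pq , q-minimal = go (rec r⊂p) Pr
    in  q , proj₁ r⊂p ∘ q⊆r , Pq , q-minimal

¬¬-Π-Fin : {P : Fin n → Set} → (∀ i → ¬ ¬ P i) → ¬ ¬ (∀ i → P i)
¬¬-Π-Fin {ℕ.zero}  _   ¬∀P = ¬∀P λ ()
¬¬-Π-Fin {ℕ.suc n} ¬¬P ¬∀P = ¬¬P zero λ P₀ → ¬¬-Π-Fin (¬¬P ∘ suc) λ Pₛ →
  ¬∀P λ { zero → P₀ ; (suc i) → Pₛ i }

¬¬-decidable : (_∼_ : Fin n → Fin n → Set) → ¬ ¬ Decidable _∼_
¬¬-decidable _ = ¬¬-Π-Fin λ _ → ¬¬-Π-Fin λ _ → ¬¬-excluded-middle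

module _ (G : Graph) where
  open Graph G using (Adj; irrefl)

  isVertexCover? : Decidable Adj → U.Decidable (IsVertexCover G)
  isVertexCover? adj? S =
    all? λ u → all? λ v → adj? u v →-dec (u ∈? S ⊎-dec v ∈? S)

  ⊤-v-isVertexCover : ∀ v → IsVertexCover G (⊤ - v)
  ⊤-v-isVertexCover v u w u~w with u ≟ᶠ v
  ... | no  u≢v  = inj₁ (x∈p∧x≢y⇒x∈p-y ∈⊤ u≢v)
  ... | yes refl = inj₂ (x∈p∧x≢y⇒x∈p-y ∈⊤ λ { refl → irrefl u~w })

  minimalVertexCoverAvoiding : Decidable Adj → ∀ v →
    ∃ λ S → v ∉ S × IsMinimalVertexCover G S
  minimalVertexCoverAvoiding adj? v =
    let S , S⊆⊤-v , S-minimal = ⊂-minimal (isVertexCover? adj?) (⊤-v-isVertexCover v)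
    in  S , (λ v∈S → x∈p-y⇒x≢y (S⊆⊤-v v∈S) refl) , S-minimal

  isIndependent⇒complement-isVertexCover : ∀ {C H} → IsIndependent G C →
    (∀ v → v ∈ C ⊎ v ∈ H) → IsVertexCover G H
  isIndependent⇒complement-isVertexCover C-independent C∪H u v u~v
    with C∪H u | C∪H v
  ... | inj₂ u∈H | _        = inj₁ u∈H
  ... | inj₁ _   | inj₂ v∈H = inj₂ v∈H
  ... | inj₁ u∈C | inj₁ v∈C = ⊥-elim (C-independent u v u∈C v∈C u~v)

  isVertexCover∧externalNeighbours⇒isMinimal : ∀ {H} → IsVertexCover G H →
    (∀ {h} → h ∈ H → ∃ λ u → u ∉ H × Adj h u) → IsMinimalVertexCover G H
  isVertexCover∧externalNeighbours⇒isMinimal H-cover ext =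
    H-cover , λ { T (T⊆H , h , h∈H , h∉T) T-cover →
      let u , u∉H , h~u = ext h∈H in
      [ h∉T , u∉H ∘ T⊆H ]′ (T-cover h u h~u) }

module Matching (G : Graph) {C H : Subset (Graph.n G)}
                (C-disjoint-H : ∀ v → v ∈ C → v ∉ H)
                (M : HasSaturatingMatching G C H) where
  open Graph G using (Adj)

  f : Vertex G → Vertex G
  f = proj₁ M

  f-edge : ∀ h → h ∈ H → f h ∈ C × Adj h (f h)
  f-edge = proj₁ (proj₂ M)

  f-injective : ∀ h h′ → h ∈ H → h′ ∈ H → f h ≡ f h′ → h ≡ h′
  f-injective = proj₂ (proj₂ M)

  Matched : Pred (Vertex G) 0ℓ
  Matched c = ∃ λ h → h ∈ H × f h ≡ c

  matched? : U.Decidable Matched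
  matched? c = any? λ h → h ∈? H ×-dec f h ≟ᶠ c

  H↪C : H ↪ C
  H↪C = record
    { to           = λ {h} _ → f h
    ; to-∈         = λ h∈H → proj₁ (f-edge _ h∈H)
    ; to-injective = f-injective _ _
    }

  C↪H : (∀ {c} → c ∈ C → Matched c) → C ↪ H
  C↪H matched = record
    { to           = proj₁ ∘ matched
    ; to-∈         = proj₁ ∘ proj₂ ∘ matched
    ; to-injective = λ {c} {c′} c∈C c′∈C eq → begin
        c                        ≡⟨ proj₂ (proj₂ (matched c∈C)) ⟨
        f (proj₁ (matched c∈C))  ≡⟨ cong f eq ⟩
        f (proj₁ (matched c′∈C)) ≡⟨ proj₂ (proj₂ (matched c′∈C)) ⟩
        c′                       ∎
    }
    where open ≡-Reasoning

  H-externalNeighbours : ∀ {h} → h ∈ H → ∃ λ u → u ∉ H × Adj h u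
  H-externalNeighbours h∈H =
    let fh∈C , h~fh = f-edge _ h∈H in f _ , C-disjoint-H _ fh∈C , h~fh

  H↪S-c : ∀ {S c} → IsVertexCover G S → c ∈ C → ¬ Matched c → H ↪ S - c
  H↪S-c {S} {c} S-cover c∈C unmatched = record
    { to           = λ {h} _ → swap h (h ∈? S)
    ; to-∈         = λ {h} → swap-∈ (h ∈? S)
    ; to-injective = λ {h} {h′} → swap-injective (h ∈? S) (h′ ∈? S)
    }
    where
    swap : ∀ h → Dec (h ∈ S) → Vertex G
    swap h (yes _) = h
    swap h (no  _) = f h

    swap-∈ : ∀ {h} (h∈S? : Dec (h ∈ S)) → h ∈ H → swap h h∈S? ∈ S - c
    swap-∈ (yes h∈S) h∈H =
      x∈p∧x≢y⇒x∈p-y h∈S λ { refl → C-disjoint-H _ c∈C h∈H }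
    swap-∈ {h} (no h∉S) h∈H =
      x∈p∧x≢y⇒x∈p-y ([ ⊥-elim ∘ h∉S , id ]′ (S-cover h (f h) (proj₂ (f-edge h h∈H))))
                     λ fh≡c → unmatched (h , h∈H , fh≡c)

    swap-injective : ∀ {h h′} (h∈S? : Dec (h ∈ S)) (h′∈S? : Dec (h′ ∈ S)) →
      h ∈ H → h′ ∈ H → swap h h∈S? ≡ swap h′ h′∈S? → h ≡ h′
    swap-injective (yes _) (yes _) _   _    h≡h′ = h≡h′
    swap-injective (yes _) (no  _) h∈H h′∈H refl =
      ⊥-elim (C-disjoint-H _ (proj₁ (f-edge _ h′∈H)) h∈H)
    swap-injective (no  _) (yes _) h∈H h′∈H refl =
      ⊥-elim (C-disjoint-H _ (proj₁ (f-edge _ h∈H)) h′∈H)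
    swap-injective (no  _) (no  _) h∈H h′∈H fh≡fh′ = f-injective _ _ h∈H h′∈H fh≡fh′

  wellCovered⇒matched : Decidable Adj → WellCovered G → IsMinimalVertexCover G H →
    ∀ {c v} → c ∈ C → Adj c v → Matched c
  wellCovered⇒matched adj? wc H-minimal {c} {v} c∈C c~v =
    decidable-stable (matched? c) (coverAvoiding-v⇒matched (minimalVertexCoverAvoiding G adj? v))
    where
    coverAvoiding-v⇒matched : (∃ λ S → v ∉ S × IsMinimalVertexCover G S) → ¬ ¬ Matched c
    coverAvoiding-v⇒matched (S , v∉S , S-minimal@(S-cover , _)) unmatched =
      <-irrefl (sym (wc S H S-minimal H-minimal)) (begin-strict
        ∣ H ∣     ≤⟨ p↪q⇒∣p∣≤∣q∣ (H↪S-c S-cover c∈C unmatched) ⟩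
        ∣ S - c ∣ <⟨ x∈p⇒∣p-x∣<∣p∣ c∈S ⟩
        ∣ S ∣     ∎)
      where
      open ≤-Reasoning
      c∈S : c ∈ S
      c∈S = [ id , ⊥-elim ∘ v∉S ]′ (S-cover c v c~v)

lemma6 : (G : Graph) → NoIsolatedVertices G →
    (C H R : Subset (Graph.n G)) → IsCrownDecomposition G C H R → R ≡ ⊥ →
    WellCovered G → ∣ C ∣ ≡ ∣ H ∣
lemma6 G noIsolated C H R ((C∪H∪R , C-disjoint-H , _ , _) , _ , C-independent , _ , M) R≡⊥ wc =
  decidable-stable (∣ C ∣ ≟ ∣ H ∣) (¬¬-map sizesEqual (¬¬-decidable (Graph.Adj G)))
  where
  open Matching G C-disjoint-H M

  C∪H : ∀ v → v ∈ C ⊎ v ∈ H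
  C∪H v = [ inj₁ , [ inj₂ , (λ v∈R → ⊥-elim (∉⊥ (subst (v ∈_) R≡⊥ v∈R))) ]′ ]′ (C∪H∪R v)

  H-minimal : IsMinimalVertexCover G H
  H-minimal = isVertexCover∧externalNeighbours⇒isMinimal G
    (isIndependent⇒complement-isVertexCover G C-independent C∪H) H-externalNeighbours

  sizesEqual : Decidable (Graph.Adj G) → ∣ C ∣ ≡ ∣ H ∣
  sizesEqual adj? = ≤-antisym
    (p↪q⇒∣p∣≤∣q∣ (C↪H λ c∈C → wellCovered⇒matched adj? wc H-minimal c∈C (proj₂ (noIsolated _))))
    (p↪q⇒∣p∣≤∣q∣ H↪C)
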